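{- Let $(t_n)_{n\ge 0}$ be a non-trivial subprime Fibonacci sequence. Then there are infinitely many indices $n\ge 2$ such that $t_n$ is prime and $t_n>\max(t_{n-2},t_{n-1})$. (The primes $t_n$ need not be distinct.)
   Context: A subprime Fibonacci sequence is a sequence $(t_n)_{n\ge0}$ of positive integers in which $t_0,t_1$ are arbitrary positive integers and, for every $n\ge0$, with $s=t_n+t_{n+1}$: $t_{n+2}=s$ if $s$ is prime, and $t_{n+2}=s/p$ if $s$ is composite, where $p$ is the smallest prime factor of $s$. Such a sequence is called trivial if it is eventually constant, and non-trivial otherwise. -}

module Defs where

open import Data.Nat using (ℕ; suc; _+_; _*_; _≤_; _<_; _⊔_)
open import Data.Nat.Divisibility using (_∣_)
open import Data.Nat.Primality using (Prime; Composite)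
open import Data.Product using (Σ; _×_; ∃)
open import Relation.Binary.PropositionalEquality using (_≡_)

IsSmallestPrimeFactor : ℕ → ℕ → Set
IsSmallestPrimeFactor p s = Prime p × p ∣ s × (∀ q → Prime q → q ∣ s → p ≤ q)

SubprimeStep : ℕ → ℕ → Set
SubprimeStep s u =
  (Prime s → u ≡ s) ×
  (Composite s → ∀ p → IsSmallestPrimeFactor p s → u * p ≡ s)

IsSubprimeFib : (ℕ → ℕ) → Set
IsSubprimeFib t = (∀ n → 0 < t n) × (∀ n → SubprimeStep (t n + t (suc n)) (t (suc (suc n))))

Trivial : (ℕ → ℕ) → Set
Trivial t = Σ ℕ λ N → ∀ n → N ≤ n → t n ≡ t N

{-# OPTIONS --safe #-}
-- If t (n+2) is not a prime record then t n + t (n+1) is composite and t (n+2) is at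
-- most half of it, hence below t n ⊔ t (n+1) unless t n = t (n+1); equal neighbours
-- force a constant tail (or the prime sum 1 + 1).  So two consecutive non-records make
-- t n ⊔ t (n+1) drop strictly, and well-founded induction on it finds a record beyond
-- every index.
module Submission where

open import Defs
open import Data.Nat using (ℕ; zero; suc; _+_; _*_; _∸_; _≤_; _<_; _⊔_; NonTrivial; _≟_)
open import Data.Nat.Base using (n>1⇒nonTrivial; nonTrivial⇒n>1)
open import Data.Nat.Properties
open import Data.Nat.Divisibility using (_∣_; _∣?_; divides)
open import Data.Nat.Divisibility.Core using (hasNonTrivialDivisor)
open import Data.Nat.Induction using (<-wellFounded)
open import Data.Nat.Primality
open import Data.Product using (Σ; _×_; _,_; proj₁; proj₂)
open import Data.Sum using (_⊎_; inj₁; inj₂)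
open import Data.Empty using (⊥-elim)
open import Induction.WellFounded using (Acc; acc)
open import Relation.Nullary using (¬_; yes; no)
open import Relation.Binary.Definitions using (tri<; tri≈; tri>)
open import Relation.Binary.PropositionalEquality using (_≡_; _≢_; refl; sym; trans; cong; cong₂; subst)

rough∧∣⇒isSmallestPrimeFactor : ∀ {p s} → .{{NonTrivial p}} → p Rough s → p ∣ s →
                                IsSmallestPrimeFactor p s
rough∧∣⇒isSmallestPrimeFactor r p∣s =
  rough∧∣⇒prime r p∣s , p∣s ,
  λ q q-prime q∣s → ≮⇒≥ λ q<p → r (hasNonTrivialDivisor {{prime⇒nonTrivial q-prime}} q<p q∣s)

module _ (s : ℕ) .{{_ : NonTrivial s}} where

  smallestPrimeFactorFrom : ∀ fuel k → .{{NonTrivial k}} → k Rough s → s ≤ k + fuel →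
                            Σ ℕ λ p → IsSmallestPrimeFactor p s
  smallestPrimeFactorFrom fuel k r s≤k+fuel with k ∣? s
  ... | yes k∣s = k , rough∧∣⇒isSmallestPrimeFactor r k∣s
  ... | no k∤s with fuel
  ...   | zero = ⊥-elim (<⇒≱ (rough⇒≤ (∤⇒rough-suc k∤s r)) (subst (s ≤_) (+-identityʳ k) s≤k+fuel))
  ...   | suc fuel′ = smallestPrimeFactorFrom fuel′ (suc k) {{n>1⇒nonTrivial (m<n⇒m<1+n (nonTrivial⇒n>1 k))}}
                        (∤⇒rough-suc k∤s r) (subst (s ≤_) (+-suc k fuel′) s≤k+fuel)

  smallestPrimeFactor : Σ ℕ λ p → IsSmallestPrimeFactor p s
  smallestPrimeFactor = smallestPrimeFactorFrom s 2 2-rough (m≤n+m s 2)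

m⊔n<m+n : ∀ {m n} → 0 < m → 0 < n → m ⊔ n < m + n
m⊔n<m+n {m} {n} 0<m 0<n = ⊔-lub (subst (_≤ m + n) (+-comm m 1) (+-monoʳ-≤ m 0<n)) (+-monoˡ-≤ n 0<m)

m≢n⇒m+n<2*[m⊔n] : ∀ {m n} → m ≢ n → m + n < (m ⊔ n) + (m ⊔ n)
m≢n⇒m+n<2*[m⊔n] {m} {n} m≢n with <-cmp m n
... | tri< m<n _ _ = +-mono-<-≤ (<-≤-trans m<n (m≤n⊔m m n)) (m≤n⊔m m n)
... | tri≈ _ m≡n _ = ⊥-elim (m≢n m≡n)
... | tri> _ _ n<m = +-mono-≤-< (m≤m⊔n m n) (<-≤-trans n<m (m≤m⊔n m n))

m+m<n+n⇒m<n : ∀ {m n} → m + m < n + n → m < n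
m+m<n+n⇒m<n m+m<n+n = ≰⇒> λ n≤m → <⇒≱ m+m<n+n (+-mono-≤ n≤m n≤m)

n*2≡n+n : ∀ n → n * 2 ≡ n + n
n*2≡n+n n = trans (*-comm n 2) (cong (n +_) (+-identityʳ n))

SubprimeStep-composite⇒halves : ∀ {s u} → SubprimeStep s u → 1 < s → ¬ Prime s → u + u ≤ s
SubprimeStep-composite⇒halves {s} {u} step 1<s s-not-prime = begin
  u + u  ≡⟨ n*2≡n+n u ⟨
  u * 2  ≤⟨ *-monoʳ-≤ u (nonTrivial⇒n>1 p {{prime⇒nonTrivial p-prime}}) ⟩
  u * p  ≡⟨ proj₂ step (¬prime⇒composite s-not-prime) p p-smallest ⟩
  s      ∎
  where
    open ≤-Reasoning
    instance _ = n>1⇒nonTrivial 1<s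
    p = proj₁ (smallestPrimeFactor s)
    p-smallest = proj₂ (smallestPrimeFactor s)
    p-prime = proj₁ p-smallest

SubprimeStep-double : ∀ {x u} → SubprimeStep (x + x) u → 2 ≤ x → u ≡ x
SubprimeStep-double {x} {u} step 2≤x =
  *-cancelʳ-≡ u x 2 (trans (proj₂ step x+x-composite 2 2-smallest) (sym (n*2≡n+n x)))
  where
    2∣x+x : 2 ∣ x + x
    2∣x+x = divides x (sym (n*2≡n+n x))
    2-smallest : IsSmallestPrimeFactor 2 (x + x)
    2-smallest = rough∧∣⇒isSmallestPrimeFactor 2-rough 2∣x+x
    x+x-composite : Composite (x + x)
    x+x-composite = composite (≤-trans (n≤1+n 3) (+-mono-≤ 2≤x 2≤x)) 2∣x+x

module _ (t : ℕ → ℕ) (subprime : IsSubprimeFib t) where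

  private
    positive = proj₁ subprime
    step = proj₂ subprime

  constantTail : ∀ n → t n ≡ t (suc n) → 2 ≤ t n → ∀ k → t (k + n) ≡ t n × t (suc (k + n)) ≡ t n
  constantTail n tn≡tn+1 2≤tn zero = refl , sym tn≡tn+1
  constantTail n tn≡tn+1 2≤tn (suc k) = next≡ , SubprimeStep-double step′ 2≤tn
    where
      m = k + n
      next≡ = proj₂ (constantTail n tn≡tn+1 2≤tn k)
      step′ : SubprimeStep (t n + t n) (t (suc (suc m)))
      step′ = subst (λ s → SubprimeStep s (t (suc (suc m))))
                (cong₂ _+_ (proj₁ (constantTail n tn≡tn+1 2≤tn k)) next≡) (step m)

  equalNeighbours⇒trivial : ∀ n → t n ≡ t (suc n) → 2 ≤ t n → Trivial t
  equalNeighbours⇒trivial n tn≡tn+1 2≤tn = n , λ m n≤m →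
    subst (λ i → t i ≡ t n) (m∸n+n≡m n≤m) (proj₁ (constantTail n tn≡tn+1 2≤tn (m ∸ n)))

  neighbourMax : ℕ → ℕ
  neighbourMax n = t n ⊔ t (suc n)

  PrimeRecord : ℕ → Set
  PrimeRecord n = Prime (t (suc (suc n))) × neighbourMax n < t (suc (suc n))

  Halving : ℕ → Set
  Halving n = ¬ Prime (t n + t (suc n)) × t (suc (suc n)) + t (suc (suc n)) ≤ t n + t (suc n)

  primeRecord⊎halving : ∀ n → PrimeRecord n ⊎ Halving n
  primeRecord⊎halving n with prime? (t n + t (suc n))
  ... | yes sum-prime =
    inj₁ (subst Prime (sym next≡sum) sum-prime ,
          subst (neighbourMax n <_) (sym next≡sum) (m⊔n<m+n (positive n) (positive (suc n))))
    where next≡sum = proj₁ (step n) sum-prime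
  ... | no sum-not-prime = inj₂ (sum-not-prime ,
         SubprimeStep-composite⇒halves (step n) (+-mono-≤ (positive n) (positive (suc n))) sum-not-prime)

  module _ (nontrivial : ¬ Trivial t) where

    halving⇒<neighbourMax : ∀ n → Halving n → t (suc (suc n)) < neighbourMax n
    halving⇒<neighbourMax n (sum-not-prime , halves) with t n ≟ t (suc n)
    ... | no tn≢tn+1 = m+m<n+n⇒m<n (≤-<-trans halves (m≢n⇒m+n<2*[m⊔n] tn≢tn+1))
    ... | yes tn≡tn+1 with t n ≟ 1
    ...   | yes tn≡1 = ⊥-elim (sum-not-prime (subst Prime (sym sum≡2) prime[2]))
      where sum≡2 = cong₂ _+_ tn≡1 (trans (sym tn≡tn+1) tn≡1)
    ...   | no tn≢1 = ⊥-elim (nontrivial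
                        (equalNeighbours⇒trivial n tn≡tn+1 (≤∧≢⇒< (positive n) (λ 1≡tn → tn≢1 (sym 1≡tn)))))

    halving²⇒neighbourMax-decreases : ∀ n → Halving n → Halving (suc n) →
                                      neighbourMax (suc (suc n)) < neighbourMax n
    halving²⇒neighbourMax-decreases n halving halving′ =
      ⊔-lub next<max (<-≤-trans (halving⇒<neighbourMax (suc n) halving′) max′≤max)
      where
        next<max = halving⇒<neighbourMax n halving
        max′≤max : neighbourMax (suc n) ≤ neighbourMax n
        max′≤max = ⊔-lub (m≤n⊔m (t n) (t (suc n))) (<⇒≤ next<max)

    primeRecordFrom : ∀ n → Acc _<_ (neighbourMax n) → Σ ℕ λ k → n ≤ k × PrimeRecord k
    primeRecordFrom n (acc smaller) with primeRecord⊎halving n | primeRecord⊎halving (suc n)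
    ... | inj₁ record₀ | _ = n , ≤-refl , record₀
    ... | inj₂ _ | inj₁ record₁ = suc n , n≤1+n n , record₁
    ... | inj₂ halving | inj₂ halving′
        with primeRecordFrom (suc (suc n)) (smaller (halving²⇒neighbourMax-decreases n halving halving′))
    ...   | k , n+2≤k , record₂ = k , m+n≤o⇒n≤o 2 n+2≤k , record₂

proposition1 : (t : ℕ → ℕ) → IsSubprimeFib t → ¬ Trivial t →
    ∀ N → Σ ℕ λ n → N ≤ n × Prime (t (suc (suc n))) × (t n ⊔ t (suc n)) < t (suc (suc n))
proposition1 t subprime nontrivial N =
  primeRecordFrom t subprime nontrivial N (<-wellFounded (neighbourMax t subprime N))
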